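{- Let $E$ be a finite set and let $\mathcal{O}\subseteq\{+,-,0\}^E$ satisfy (O3): $X,Y\in\mathcal{O}\Rightarrow X\circ Y\in\mathcal{O}$. Then $\mathcal{O}$ satisfies (O4): for all $X,Y\in\mathcal{O}$ with $\underline{X}=\underline{Y}$ and $X\neq Y$, $I_e(X,Y)\cap\mathcal{O}\neq\emptyset$ for every $e\in S(X,Y)$, if and only if it satisfies (O4'): for all $X,Y\in\mathcal{O}$ with $\underline{X}=\underline{Y}$ and $X\neq Y$, $I(X,Y)\cap\mathcal{O}\neq\emptyset$.
   Context: A sign vector on $E$ is $X\in\{+,-,0\}^E$ with support $\underline{X}=\{e: X_e\neq0\}$. Composition: $(X\circ Y)_e=X_e$ if $X_e\neq 0$, else $Y_e$. Separation set: $S(X,Y)=\{e: X_e,Y_e\neq0, X_e\neq Y_e\}$. For $X\neq Y$ with $\underline{X}=\underline{Y}$ and $e\in S(X,Y)$: $I_e(X,Y)=\{V\in\{+,-,0\}^E : \underline{V}\subseteq\underline{X}-\{e\},\ V_f=X_f \text{ for all } f\notin S(X,Y)\}$ and $I(X,Y)=\bigcup_{e\in S(X,Y)}I_e(X,Y)$. -}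

module Defs where

open import Data.Nat using (ℕ)
open import Data.Fin using (Fin)
open import Data.Vec using (Vec; lookup; tabulate)
open import Data.Bool using (Bool; true; false)
open import Data.Fin.Subset using (Subset; _⊆_; _∈_; _∉_)
open import Data.Product using (Σ; _×_; ∃; ∃-syntax)
open import Relation.Binary.PropositionalEquality using (_≡_; _≢_)
open import Relation.Nullary using (¬_)
open import Level using (0ℓ; suc)
open import Relation.Unary using (Pred)

data Sign : Set where
  ⊕ ⊖ 𝟘 : Sign

SignVec : ℕ → Set
SignVec n = Vec Sign n

isNonzero : Sign → Bool
isNonzero 𝟘 = false
isNonzero ⊕ = true
isNonzero ⊖ = true

supp : ∀ {n} → SignVec n → Subset n
supp X = tabulate (λ e → isNonzero (lookup X e))

_∘ₛ_ : Sign → Sign → Sign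
⊕ ∘ₛ _ = ⊕
⊖ ∘ₛ _ = ⊖
𝟘 ∘ₛ y = y

_∘ᵥ_ : ∀ {n} → SignVec n → SignVec n → SignVec n
X ∘ᵥ Y = tabulate (λ e → lookup X e ∘ₛ lookup Y e)

InSep : ∀ {n} → SignVec n → SignVec n → Fin n → Set
InSep X Y e = (lookup X e ≢ 𝟘) × (lookup Y e ≢ 𝟘) × (lookup X e ≢ lookup Y e)

InIe : ∀ {n} → SignVec n → SignVec n → Fin n → SignVec n → Set
InIe X Y e V =
  ((f : Fin _) → f ∈ supp V → (f ∈ supp X × f ≢ e)) ×
  ((f : Fin _) → ¬ InSep X Y f → lookup V f ≡ lookup X f)

InI : ∀ {n} → SignVec n → SignVec n → SignVec n → Set
InI X Y V = ∃[ e ] (InSep X Y e × InIe X Y e V)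

Family : ℕ → Set₁
Family n = SignVec n → Set

O3 : ∀ {n} → Family n → Set
O3 𝒪 = ∀ X Y → 𝒪 X → 𝒪 Y → 𝒪 (X ∘ᵥ Y)

O4 : ∀ {n} → Family n → Set
O4 𝒪 = ∀ X Y → 𝒪 X → 𝒪 Y → supp X ≡ supp Y → X ≢ Y →
  ∀ e → InSep X Y e → ∃[ V ] (InIe X Y e V × 𝒪 V)

O4' : ∀ {n} → Family n → Set
O4' 𝒪 = ∀ X Y → 𝒪 X → 𝒪 Y → supp X ≡ supp Y → X ≢ Y →
  ∃[ V ] (InI X Y V × 𝒪 V)

-- (O4) ⇒ (O4') because two distinct sign vectors with equal supports are
-- separated somewhere. For the converse we induct on |S(X,Y)|. Given
-- e ∈ S(X,Y), (O4') provides V ∈ I_f(X,Y) ∩ 𝒪 for some f ∈ S(X,Y). If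
-- V_e = 0 then V ∈ I_e(X,Y). Otherwise V_e differs from X_e or from Y_e,
-- say from X_e. Then Y′ = V ∘ X ∈ 𝒪 has the support of X, is separated
-- from X at e, and S(X,Y′) ⊆ S(X,Y) - {f}, because V agrees with X off
-- S(X,Y) and vanishes at f. The induction hypothesis for (X,Y′) yields an
-- element of I_e(X,Y′) ∩ 𝒪 ⊆ I_e(X,Y) ∩ 𝒪. The case V_e ≠ Y_e is the same
-- with X and Y exchanged, since I_e(X,Y) = I_e(Y,X) when supports agree.
module Submission where

open import Defs
open import Data.Bool using (Bool; true)
open import Data.Fin using (Fin)
open import Data.Fin.Properties using (any?)
open import Data.Fin.Subset using (Subset; _∈_; _∉_; _⊆_; _⊂_; ∣_∣)
open import Data.Fin.Subset.Properties using (p⊂q⇒∣p∣<∣q∣)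
open import Data.Nat using (ℕ; suc; _<_; _≤_; s≤s)
open import Data.Nat.Properties using (<-≤-trans; ≤-refl)
open import Data.Product using (_×_; _,_; proj₁; proj₂; ∃-syntax)
open import Data.Vec using (lookup; tabulate)
open import Data.Vec.Properties
  using (lookup∘tabulate; tabulate∘lookup; tabulate-cong; []=⇒lookup; lookup⇒[]=)
open import Function using (_∘_)
open import Function.Bundles using (mk⇔)
open import Relation.Nullary using (¬_; Dec; yes; no; does; contradiction; ¬?)
open import Relation.Nullary.Decidable using (_×-dec_; dec-true; does-⇔)
open import Relation.Binary.PropositionalEquality

variable
  n : ℕ
  x y v : Sign
  X Y : SignVec n
  e f i : Fin n

_≟_ : (x y : Sign) → Dec (x ≡ y)
⊕ ≟ ⊕ = yes refl
⊖ ≟ ⊖ = yes refl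
𝟘 ≟ 𝟘 = yes refl
⊕ ≟ ⊖ = no λ ()
⊕ ≟ 𝟘 = no λ ()
⊖ ≟ ⊕ = no λ ()
⊖ ≟ 𝟘 = no λ ()
𝟘 ≟ ⊕ = no λ ()
𝟘 ≟ ⊖ = no λ ()

Separated : Sign → Sign → Set
Separated x y = x ≢ 𝟘 × y ≢ 𝟘 × x ≢ y

separated? : ∀ x y → Dec (Separated x y)
separated? x y = ¬? (x ≟ 𝟘) ×-dec ¬? (y ≟ 𝟘) ×-dec ¬? (x ≟ y)

separated-sym : Separated x y → Separated y x
separated-sym (x≢𝟘 , y≢𝟘 , x≢y) = y≢𝟘 , x≢𝟘 , ≢-sym x≢y

¬separated⇒≡ : isNonzero x ≡ isNonzero y → ¬ Separated x y → x ≡ y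
¬separated⇒≡ {⊕} {⊕} _ _ = refl
¬separated⇒≡ {⊖} {⊖} _ _ = refl
¬separated⇒≡ {𝟘} {𝟘} _ _ = refl
¬separated⇒≡ {⊕} {⊖} _ ¬s = contradiction ((λ ()) , (λ ()) , (λ ())) ¬s
¬separated⇒≡ {⊖} {⊕} _ ¬s = contradiction ((λ ()) , (λ ()) , (λ ())) ¬s
¬separated⇒≡ {⊕} {𝟘} () _
¬separated⇒≡ {⊖} {𝟘} () _
¬separated⇒≡ {𝟘} {⊕} () _
¬separated⇒≡ {𝟘} {⊖} () _

≡⇒¬separated : y ≡ x → ¬ Separated x y
≡⇒¬separated y≡x (_ , _ , x≢y) = x≢y (sym y≡x)

isNonzero⇒≢𝟘 : isNonzero x ≡ true → x ≢ 𝟘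
isNonzero⇒≢𝟘 () refl

¬isNonzero⇒≡𝟘 : isNonzero x ≢ true → x ≡ 𝟘
¬isNonzero⇒≡𝟘 {⊕} ¬nz = contradiction refl ¬nz
¬isNonzero⇒≡𝟘 {⊖} ¬nz = contradiction refl ¬nz
¬isNonzero⇒≡𝟘 {𝟘} _ = refl

isNonzero-∘ₛ : (isNonzero v ≡ true → isNonzero x ≡ true) →
               isNonzero (v ∘ₛ x) ≡ isNonzero x
isNonzero-∘ₛ {⊕} v⇒x = sym (v⇒x refl)
isNonzero-∘ₛ {⊖} v⇒x = sym (v⇒x refl)
isNonzero-∘ₛ {𝟘} _ = refl

∘ₛ-idem : ∀ x → x ∘ₛ x ≡ x
∘ₛ-idem ⊕ = refl
∘ₛ-idem ⊖ = refl
∘ₛ-idem 𝟘 = refl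

∘ₛ-nonzero : v ≢ 𝟘 → v ∘ₛ x ≡ v
∘ₛ-nonzero {⊕} _ = refl
∘ₛ-nonzero {⊖} _ = refl
∘ₛ-nonzero {𝟘} v≢𝟘 = contradiction refl v≢𝟘

∈-tabulate⁺ : ∀ (g : Fin n → Bool) → g i ≡ true → i ∈ tabulate g
∈-tabulate⁺ {i = i} g gi = lookup⇒[]= i _ (trans (lookup∘tabulate g i) gi)

∈-tabulate⁻ : ∀ (g : Fin n → Bool) → i ∈ tabulate g → g i ≡ true
∈-tabulate⁻ {i = i} g i∈ = trans (sym (lookup∘tabulate g i)) ([]=⇒lookup i∈)

∈-supp⁻ : (X : SignVec n) → i ∈ supp X → lookup X i ≢ 𝟘
∈-supp⁻ X = isNonzero⇒≢𝟘 ∘ ∈-tabulate⁻ (isNonzero ∘ lookup X)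

∉-supp⁻ : (X : SignVec n) → i ∉ supp X → lookup X i ≡ 𝟘
∉-supp⁻ X i∉ = ¬isNonzero⇒≡𝟘 (i∉ ∘ ∈-tabulate⁺ (isNonzero ∘ lookup X))

supp-≡⇒isNonzero-≡ : (X Y : SignVec n) → supp X ≡ supp Y →
                     ∀ i → isNonzero (lookup X i) ≡ isNonzero (lookup Y i)
supp-≡⇒isNonzero-≡ X Y X≈Y i = begin
  isNonzero (lookup X i)  ≡⟨ lookup∘tabulate _ i ⟨
  lookup (supp X) i       ≡⟨ cong (λ s → lookup s i) X≈Y ⟩
  lookup (supp Y) i       ≡⟨ lookup∘tabulate _ i ⟩
  isNonzero (lookup Y i)  ∎
  where open ≡-Reasoning

lookup-∘ᵥ : ∀ (X Y : SignVec n) i → lookup (X ∘ᵥ Y) i ≡ lookup X i ∘ₛ lookup Y i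
lookup-∘ᵥ X Y = lookup∘tabulate _

supp-∘ᵥ : (V X : SignVec n) → supp V ⊆ supp X → supp (V ∘ᵥ X) ≡ supp X
supp-∘ᵥ V X V⊆X = tabulate-cong λ i → begin
  isNonzero (lookup (V ∘ᵥ X) i)        ≡⟨ cong isNonzero (lookup-∘ᵥ V X i) ⟩
  isNonzero (lookup V i ∘ₛ lookup X i) ≡⟨ isNonzero-∘ₛ (Vi⇒Xi i) ⟩
  isNonzero (lookup X i)               ∎
  where
  open ≡-Reasoning
  Vi⇒Xi : ∀ i → isNonzero (lookup V i) ≡ true → isNonzero (lookup X i) ≡ true
  Vi⇒Xi i = ∈-tabulate⁻ (isNonzero ∘ lookup X) ∘ V⊆X ∘ ∈-tabulate⁺ (isNonzero ∘ lookup V)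

does≡true⇒ : ∀ {A : Set} (a? : Dec A) → does a? ≡ true → A
does≡true⇒ (yes a) _ = a

Sep : SignVec n → SignVec n → Subset n
Sep X Y = tabulate λ i → does (separated? (lookup X i) (lookup Y i))

∈-Sep⁺ : (X Y : SignVec n) → InSep X Y i → i ∈ Sep X Y
∈-Sep⁺ {i = i} X Y s = ∈-tabulate⁺ _ (dec-true (separated? (lookup X i) (lookup Y i)) s)

∈-Sep⁻ : (X Y : SignVec n) → i ∈ Sep X Y → InSep X Y i
∈-Sep⁻ {i = i} X Y i∈ = does≡true⇒ (separated? (lookup X i) (lookup Y i)) (∈-tabulate⁻ _ i∈)

Sep-comm : (X Y : SignVec n) → Sep X Y ≡ Sep Y X
Sep-comm X Y = tabulate-cong λ i →
  does-⇔ (mk⇔ separated-sym separated-sym)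
    (separated? (lookup X i) (lookup Y i)) (separated? (lookup Y i) (lookup X i))

InSep⇒≢ : InSep X Y e → X ≢ Y
InSep⇒≢ (_ , _ , Xe≢Ye) refl = Xe≢Ye refl

¬InSep⇒lookup-≡ : (X Y : SignVec n) → supp X ≡ supp Y → ¬ InSep X Y i →
                  lookup X i ≡ lookup Y i
¬InSep⇒lookup-≡ {i = i} X Y X≈Y = ¬separated⇒≡ (supp-≡⇒isNonzero-≡ X Y X≈Y i)

¬InSep⇒≡ : supp X ≡ supp Y → (∀ i → ¬ InSep X Y i) → X ≡ Y
¬InSep⇒≡ {X = X} {Y} X≈Y ¬S = begin
  X                  ≡⟨ tabulate∘lookup X ⟨
  tabulate (lookup X) ≡⟨ tabulate-cong (λ i → ¬InSep⇒lookup-≡ X Y X≈Y (¬S i)) ⟩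
  tabulate (lookup Y) ≡⟨ tabulate∘lookup Y ⟩
  Y                  ∎
  where open ≡-Reasoning

InIe-zero : (X Y V : SignVec n) → lookup V e ≡ 𝟘 → InIe X Y f V → InIe X Y e V
InIe-zero X Y V Ve≡𝟘 (V⊆ , V≈X) =
  (λ g g∈ → proj₁ (V⊆ g g∈) , λ { refl → ∈-supp⁻ V g∈ Ve≡𝟘 }) , V≈X

InIe-mono : (X Y V W : SignVec n) → Sep X Y ⊆ Sep X V → InIe X Y e W → InIe X V e W
InIe-mono X Y V W S⊆ (W⊆ , W≈X) =
  W⊆ , λ g ¬s → W≈X g (¬s ∘ ∈-Sep⁻ X V ∘ S⊆ ∘ ∈-Sep⁺ X Y)

InIe-sym : (X Y V : SignVec n) → supp X ≡ supp Y → InIe X Y e V → InIe Y X e V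
InIe-sym X Y V X≈Y (V⊆ , V≈X) =
  (λ g g∈ → let g∈X , g≢e = V⊆ g g∈ in subst (g ∈_) X≈Y g∈X , g≢e) ,
  λ g ¬s → trans (V≈X g (¬s ∘ separated-sym))
                  (¬InSep⇒lookup-≡ X Y X≈Y (¬s ∘ separated-sym))

-- V ∘ X keeps X off S(X,Y) and at f, and copies V elsewhere.
module _ (X Y V : SignVec n) (V∈I : InIe X Y f V) (f∈S : InSep X Y f) where

  supp-∘ᵥ-InIe : supp (V ∘ᵥ X) ≡ supp X
  supp-∘ᵥ-InIe = supp-∘ᵥ V X λ {g} g∈ → proj₁ (proj₁ V∈I g g∈)

  Sep-∘ᵥ-⊂ : Sep X (V ∘ᵥ X) ⊂ Sep X Y
  Sep-∘ᵥ-⊂ = ⊆-Sep , f , ∈-Sep⁺ X Y f∈S , ≡⇒¬separated composed-at-f ∘ ∈-Sep⁻ X (V ∘ᵥ X)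
    where
    composed-at-f : lookup (V ∘ᵥ X) f ≡ lookup X f
    composed-at-f = begin
      lookup (V ∘ᵥ X) f        ≡⟨ lookup-∘ᵥ V X f ⟩
      lookup V f ∘ₛ lookup X f ≡⟨ cong (_∘ₛ lookup X f) Vf≡𝟘 ⟩
      lookup X f               ∎
      where
      open ≡-Reasoning
      Vf≡𝟘 : lookup V f ≡ 𝟘
      Vf≡𝟘 = ∉-supp⁻ V λ f∈ → proj₂ (proj₁ V∈I f f∈) refl

    ⊆-Sep : Sep X (V ∘ᵥ X) ⊆ Sep X Y
    ⊆-Sep {g} g∈ with separated? (lookup X g) (lookup Y g)
    ... | yes s = ∈-Sep⁺ X Y s
    ... | no ¬s = contradiction (∈-Sep⁻ X (V ∘ᵥ X) g∈) (≡⇒¬separated (begin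
      lookup (V ∘ᵥ X) g        ≡⟨ lookup-∘ᵥ V X g ⟩
      lookup V g ∘ₛ lookup X g ≡⟨ cong (_∘ₛ lookup X g) (proj₂ V∈I g ¬s) ⟩
      lookup X g ∘ₛ lookup X g ≡⟨ ∘ₛ-idem (lookup X g) ⟩
      lookup X g               ∎))
      where open ≡-Reasoning

  InSep-∘ᵥ : InSep X Y e → lookup V e ≢ 𝟘 → lookup V e ≢ lookup X e →
             InSep X (V ∘ᵥ X) e
  InSep-∘ᵥ {e} (Xe≢𝟘 , _) Ve≢𝟘 Ve≢Xe =
    Xe≢𝟘 ,
    subst (_≢ 𝟘) (sym Ve∘Xe≡Ve) Ve≢𝟘 ,
    subst (lookup X e ≢_) (sym Ve∘Xe≡Ve) (≢-sym Ve≢Xe)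
    where
    Ve∘Xe≡Ve : lookup (V ∘ᵥ X) e ≡ lookup V e
    Ve∘Xe≡Ve = trans (lookup-∘ᵥ V X e) (∘ₛ-nonzero Ve≢𝟘)

O4⇒O4' : {𝒪 : Family n} → O4 𝒪 → O4' 𝒪
O4⇒O4' o4 X Y oX oY X≈Y X≢Y with any? (λ i → separated? (lookup X i) (lookup Y i))
... | yes (e , e∈S) =
  let V , V∈I , oV = o4 X Y oX oY X≈Y X≢Y e e∈S in V , (e , e∈S , V∈I) , oV
... | no ¬S = contradiction (¬InSep⇒≡ X≈Y λ i s → ¬S (i , s)) X≢Y

module _ {𝒪 : Family n} (o3 : O3 𝒪) (o4' : O4' 𝒪) where

  O4-below : ∀ k X Y → 𝒪 X → 𝒪 Y → supp X ≡ supp Y → ∣ Sep X Y ∣ < k →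
             ∀ e → InSep X Y e → ∃[ W ] (InIe X Y e W × 𝒪 W)

  O4-below-∘ᵥ : ∀ k X Y V {f e} → 𝒪 X → 𝒪 V → ∣ Sep X Y ∣ ≤ k →
                InSep X Y f → InIe X Y f V → InSep X Y e →
                lookup V e ≢ 𝟘 → lookup V e ≢ lookup X e →
                ∃[ W ] (InIe X Y e W × 𝒪 W)

  O4-below (suc k) X Y oX oY X≈Y (s≤s bound) e e∈S
    with o4' X Y oX oY X≈Y (InSep⇒≢ e∈S)
  ... | V , (f , f∈S , V∈I) , oV with lookup V e ≟ 𝟘 | lookup V e ≟ lookup X e
  ... | yes Ve≡𝟘 | _ = V , InIe-zero X Y V Ve≡𝟘 V∈I , oV
  ... | no Ve≢𝟘 | no Ve≢Xe = O4-below-∘ᵥ k X Y V oX oV bound f∈S V∈I e∈S Ve≢𝟘 Ve≢Xe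
  ... | no Ve≢𝟘 | yes Ve≡Xe =
    let W , W∈I , oW = O4-below-∘ᵥ k Y X V oY oV bound′
                         (separated-sym f∈S) (InIe-sym X Y V X≈Y V∈I) (separated-sym e∈S)
                         Ve≢𝟘 Ve≢Ye
    in W , InIe-sym Y X W (sym X≈Y) W∈I , oW
    where
    bound′ : ∣ Sep Y X ∣ ≤ k
    bound′ = subst (λ S → ∣ S ∣ ≤ k) (Sep-comm X Y) bound
    Ve≢Ye : lookup V e ≢ lookup Y e
    Ve≢Ye Ve≡Ye = proj₂ (proj₂ e∈S) (trans (sym Ve≡Xe) Ve≡Ye)

  O4-below-∘ᵥ k X Y V {e = e} oX oV bound f∈S V∈I e∈S Ve≢𝟘 Ve≢Xe =
    let W , W∈I , oW = O4-below k X (V ∘ᵥ X) oX (o3 V X oV oX) (sym (supp-∘ᵥ-InIe X Y V V∈I f∈S))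
                         (<-≤-trans (p⊂q⇒∣p∣<∣q∣ shrinks) bound)
                         e (InSep-∘ᵥ X Y V V∈I f∈S e∈S Ve≢𝟘 Ve≢Xe)
    in W , InIe-mono X (V ∘ᵥ X) Y W (proj₁ shrinks) W∈I , oW
    where
    shrinks : Sep X (V ∘ᵥ X) ⊂ Sep X Y
    shrinks = Sep-∘ᵥ-⊂ X Y V V∈I f∈S

  O4'⇒O4 : O4 𝒪
  O4'⇒O4 X Y oX oY X≈Y _ = O4-below (suc ∣ Sep X Y ∣) X Y oX oY X≈Y ≤-refl

lemma2p1 : (n : ℕ) (𝒪 : Family n) → O3 𝒪 →
    (O4 𝒪 → O4' 𝒪) × (O4' 𝒪 → O4 𝒪)
lemma2p1 n 𝒪 o3 = O4⇒O4' , O4'⇒O4 o3
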